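{- Let $G$ be a finite, simple, undirected, biconnected graph. If $G$ is not bipartite, then $G$ admits no robust maximal independent set.
   Context: A graph is biconnected if it has at least three vertices and remains connected after the removal of any single vertex. A connected spanning subgraph of $G=(V,E_G)$ is a connected graph $H=(V,E_H)$ with $E_H\subseteq E_G$. A maximal independent set (MIS) is a set of pairwise non-adjacent vertices maximal for inclusion. An MIS $S$ of $G$ is robust if $S$ is a maximal independent set in every connected spanning subgraph of $G$ (including $G$ itself). -}

module Defs where

open import Data.Nat using (ℕ; _≥_)
open import Data.Fin using (Fin)
open import Data.Fin.Subset using (Subset; _∈_; _∉_; _⊆_)
open import Data.Bool using (Bool)
open import Data.Product using (Σ; _×_; ∃)
open import Data.Empty using (⊥)
open import Relation.Nullary using (¬_; Dec)
open import Relation.Binary.PropositionalEquality using (_≡_; _≢_)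
open import Relation.Binary.Construct.Closure.ReflexiveTransitive using (Star)

record Graph (n : ℕ) : Set₁ where
  field
    Adj   : Fin n → Fin n → Set
    adj?  : ∀ u v → Dec (Adj u v)
    sym   : ∀ {u v} → Adj u v → Adj v u
    irrefl : ∀ {u} → ¬ Adj u u
open Graph public

Connected : ∀ {n} → Graph n → Set
Connected G = ∀ u v → Star (Adj G) u v

AdjWithout : ∀ {n} → Graph n → Fin n → Fin n → Fin n → Set
AdjWithout G w u v = (u ≢ w) × (v ≢ w) × Adj G u v

Biconnected : ∀ {n} → Graph n → Set
Biconnected {n} G =
  (n ≥ 3) × (∀ w u v → u ≢ w → v ≢ w → Star (AdjWithout G w) u v)

Bipartite : ∀ {n} → Graph n → Set
Bipartite {n} G = Σ (Fin n → Bool) λ c → ∀ u v → Adj G u v → c u ≢ c v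

SpanningSubgraph : ∀ {n} → Graph n → Graph n → Set
SpanningSubgraph H G = ∀ u v → Adj H u v → Adj G u v

Independent : ∀ {n} → Graph n → Subset n → Set
Independent G S = ∀ u v → u ∈ S → v ∈ S → ¬ Adj G u v

MIS : ∀ {n} → Graph n → Subset n → Set
MIS G S = Independent G S × (∀ T → Independent G T → S ⊆ T → T ⊆ S)

RobustMIS : ∀ {n} → Graph n → Subset n → Set₁
RobustMIS G S = MIS G S × (∀ H → SpanningSubgraph H G → Connected H → MIS H S)

-- A robust MIS S of a biconnected graph G meets every edge exactly once, so
-- membership in S is a proper 2-colouring. If an
-- edge uv missed S, delete all edges between u and S: the result stays connected
-- (G − u is connected and uv survives), yet u has no neighbour in S there, so
-- S ∪ {u} is independent and S is not maximal in it.
module Submission where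

open import Defs
open import Data.Fin using (Fin; _≟_)
open import Data.Fin.Subset using (Subset; _∈_; _∉_; _∪_; ⁅_⁆)
open import Data.Fin.Subset.Properties
  using (_∈?_; x∈⁅x⁆; x∈⁅y⁆⇒x≡y; x∈p∪q⁻; p⊆p∪q; q⊆p∪q)
open import Data.Vec using (lookup)
open import Data.Vec.Properties using ([]=⇒lookup; lookup⇒[]=)
open import Data.Product using (_×_; _,_)
open import Data.Sum using (_⊎_; inj₁; inj₂)
import Data.Sum as Sum
open import Data.Empty using (⊥-elim)
open import Relation.Nullary using (¬_; yes; no)
open import Relation.Nullary.Decidable.Core using (_×-dec_; _→-dec_; ¬?)
open import Relation.Binary.PropositionalEquality using (_≡_; _≢_; refl; trans)
  renaming (sym to ≡-sym)
open import Relation.Binary.Construct.Closure.ReflexiveTransitive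
  using (Star; ε; _◅_; _◅◅_; gmap; reverse)

∈-∪-⁅⁆ : ∀ {n} (S : Subset n) {x u} → x ∈ S ∪ ⁅ u ⁆ → x ∈ S ⊎ x ≡ u
∈-∪-⁅⁆ S {u = u} x∈ = Sum.map₂ (x∈⁅y⁆⇒x≡y u) (x∈p∪q⁻ S ⁅ u ⁆ x∈)

module _ {n} (G : Graph n) where

  independent-⊇ : ∀ H {S} → SpanningSubgraph H G → Independent G S → Independent H S
  independent-⊇ _ H⊆G ind a b a∈ b∈ e = ind a b a∈ b∈ (H⊆G a b e)

  independent-∪-⁅⁆ : ∀ {S u} → Independent G S → (∀ s → s ∈ S → ¬ Adj G u s) →
                     Independent G (S ∪ ⁅ u ⁆)
  independent-∪-⁅⁆ {S} {u} ind u≁S a b a∈ b∈ e with ∈-∪-⁅⁆ S a∈ | ∈-∪-⁅⁆ S b∈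
  ... | inj₁ a∈S | inj₁ b∈S = ind a b a∈S b∈S e
  ... | inj₁ a∈S | inj₂ refl = u≁S a a∈S (Graph.sym G e)
  ... | inj₂ refl | inj₁ b∈S = u≁S b b∈S e
  ... | inj₂ refl | inj₂ refl = Graph.irrefl G e

  MIS-absorbs : ∀ {S u} → MIS G S → Independent G (S ∪ ⁅ u ⁆) → u ∈ S
  MIS-absorbs {S} {u} (_ , maximal) ind =
    maximal (S ∪ ⁅ u ⁆) ind (p⊆p∪q ⁅ u ⁆) (q⊆p∪q S ⁅ u ⁆ (x∈⁅x⁆ u))

  connected-via : ∀ v → (∀ a → Star (Adj G) a v) → Connected G
  connected-via v reach a b = reach a ◅◅ reverse (Graph.sym G) (reach b)

  independent-cover⇒bipartite : ∀ {S} → Independent G S →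
                                (∀ u v → Adj G u v → u ∉ S → v ∈ S) → Bipartite G
  independent-cover⇒bipartite {S} ind cover = lookup S , proper
    where
    proper : ∀ a b → Adj G a b → lookup S a ≢ lookup S b
    proper a b e same with a ∈? S
    ... | yes a∈ = ind a b a∈ (lookup⇒[]= b S (trans (≡-sym same) ([]=⇒lookup a∈))) e
    ... | no a∉ = a∉ (lookup⇒[]= a S (trans same ([]=⇒lookup (cover a b e a∉))))

module _ {n} (G : Graph n) (S : Subset n) (u : Fin n) where

  DetachedAdj : Fin n → Fin n → Set
  DetachedAdj a b = Adj G a b × (a ∈ S → b ≢ u) × (b ∈ S → a ≢ u)

  detach : Graph n
  detach = record
    { Adj    = DetachedAdj
    ; adj?   = λ a b → adj? G a b
                 ×-dec ((a ∈? S) →-dec ¬? (b ≟ u))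
                 ×-dec ((b ∈? S) →-dec ¬? (a ≟ u))
    ; sym    = λ { (e , p , q) → Graph.sym G e , q , p }
    ; irrefl = λ { (e , _) → Graph.irrefl G e }
    }

  detach-⊆ : SpanningSubgraph detach G
  detach-⊆ _ _ (e , _) = e

  detach-isolates : ∀ s → s ∈ S → ¬ DetachedAdj u s
  detach-isolates s s∈ (_ , _ , s≢u) = s≢u s∈ refl

  detach-connected : Biconnected G → ∀ {v} → Adj G u v → v ∉ S → Connected detach
  detach-connected (_ , G-w-connected) {v} uv v∉ = connected-via detach v reach
    where
    v≢u : v ≢ u
    v≢u refl = Graph.irrefl G uv

    avoiding-u : ∀ {a b} → Star (AdjWithout G u) a b → Star DetachedAdj a b
    avoiding-u = gmap (λ x → x) (λ { (a≢u , b≢u , e) → e , (λ _ → b≢u) , (λ _ → a≢u) })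

    reach : ∀ a → Star DetachedAdj a v
    reach a with a ≟ u
    ... | yes refl = (uv , (λ _ → v≢u) , (λ v∈ _ → v∉ v∈)) ◅ ε
    ... | no a≢u = avoiding-u (G-w-connected u a v a≢u v≢u)

robust-covers-edges : ∀ {n} (G : Graph n) (S : Subset n) → Biconnected G → RobustMIS G S →
                      ∀ u v → Adj G u v → u ∉ S → v ∈ S
robust-covers-edges {n} G S bc ((ind , _) , robust) u v uv u∉ with v ∈? S
... | yes v∈ = v∈
... | no v∉ = ⊥-elim (u∉ (MIS-absorbs H mis-H ind-H))
  where
  H : Graph n
  H = detach G S u

  mis-H : MIS H S
  mis-H = robust H (detach-⊆ G S u) (detach-connected G S u bc uv v∉)

  ind-H : Independent H (S ∪ ⁅ u ⁆)
  ind-H = independent-∪-⁅⁆ H (independent-⊇ G H (detach-⊆ G S u) ind) (detach-isolates G S u)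

robust⇒bipartite : ∀ {n} (G : Graph n) (S : Subset n) → Biconnected G → RobustMIS G S →
                   Bipartite G
robust⇒bipartite G S bc r@((ind , _) , _) =
  independent-cover⇒bipartite G ind (robust-covers-edges G S bc r)

lemma5 : ∀ {n} (G : Graph n) → Biconnected G → ¬ Bipartite G →
    ∀ (S : Subset n) → ¬ RobustMIS G S
lemma5 G bc non-bipartite S robust = non-bipartite (robust⇒bipartite G S bc robust)
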